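{- Let $n$ be a composite integer. Then the following are equivalent: (i) $n$ is a Giuga Number; (ii) $\sum_{j=1}^{n-1} j^{\lambda(n)} \equiv -1 \pmod n$; (iii) for every positive integer $K$, $\sum_{j=1}^{n-1} j^{K\lambda(n)} \equiv -1 \pmod n$; (iv) there exists a positive integer $K$ such that $\sum_{j=1}^{n-1} j^{K\lambda(n)} \equiv -1 \pmod n$; (v) there exists a positive integer $K$ such that $\sum_{j=1}^{n-1} j^{K\phi(n)} \equiv -1 \pmod n$; (vi) for every positive integer $K$, $\sum_{j=1}^{n-1} j^{K\phi(n)} \equiv -1 \pmod n$.
   Context: A Giuga Number is a composite integer $n$ such that $p$ divides $n/p-1$ for every prime divisor $p$ of $n$; equivalently (a known characterization), a composite $n$ is a Giuga Number if and only if $\sum_{j=1}^{n-1} j^{\phi(n)}\equiv -1 \pmod n$. $\phi$ is Euler's totient function and $\lambda$ is Carmichael's function: $\lambda(n)$ is the smallest positive integer $m$ with $a^m\equiv 1\pmod n$ for all $a$ coprime to $n$. -}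

module Defs where

open import Data.Nat using (ℕ; zero; suc; _+_; _*_; _∸_; _^_; _≤_; _<_)
open import Data.Nat.Properties using (_≟_)
open import Data.Nat.Divisibility using (_∣_)
open import Data.Nat.GCD using (gcd)
open import Data.Nat.Coprimality using (Coprime)
open import Data.Nat.Primality using (Prime; Composite)
open import Data.Nat.ListAction using (sum)
open import Data.List using (List; map; upTo; filter; length)
open import Data.Product using (_×_)
open import Relation.Binary.PropositionalEquality using (_≡_)

range1 : ℕ → List ℕ
range1 m = map suc (upTo m)

powSum : ℕ → ℕ → ℕ
powSum n e = sum (map (λ j → j ^ e) (range1 (n ∸ 1)))

-- a ≡ b (mod n) for naturals: n divides |a − b|
_≡_[mod_] : ℕ → ℕ → ℕ → Set
a ≡ b [mod n ] = n ∣ ((a ∸ b) + (b ∸ a))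

_≡-1[mod_] : ℕ → ℕ → Set
x ≡-1[mod n ] = n ∣ x + 1

φ : ℕ → ℕ
φ n = length (filter (λ k → gcd k n ≟ 1) (range1 n))

ExponentKills : ℕ → ℕ → Set
ExponentKills n m = ∀ a → Coprime a n → (a ^ m) ≡ 1 [mod n ]

-- Carmichael's function, relationally: IsCarmichaelλ n m  iff  m = λ(n),
-- the smallest positive m with a^m ≡ 1 (mod n) for all a coprime to n.
IsCarmichaelλ : ℕ → ℕ → Set
IsCarmichaelλ n m = 0 < m × ExponentKills n m × (∀ m′ → 0 < m′ → ExponentKills n m′ → m ≤ m′)

-- Giuga number: composite n such that p ∣ (n/p − 1) for every prime p ∣ n.
-- A prime divisor p of n with cofactor q = n/p is given by n ≡ q * p.
Giuga : ℕ → Set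
Giuga n = Composite n × (∀ p q → Prime p → n ≡ q * p → p ∣ q ∸ 1)

-- Call an exponent e > 0 admissible for n when a^e ≡ 1 (mod n) for every a coprime
-- to n; λ(n), φ(n) and all their positive multiples are admissible.
-- Let p be a prime factor of n = q p.  Admissibility descends from n to p (choose
-- a ≡ j (mod p) coprime to n by the Chinese remainder theorem), so j^e ≡ 1 (mod p)
-- for p ∤ j, while j^e ≡ 0 (mod p) for p ∣ j.  Summing over the q periods of length p
-- gives Σ j^e ≡ −q (mod p), i.e. p ∣ (Σ j^e + 1) + (q − 1).  Hence p ∣ q − 1 iff
-- p ∣ Σ j^e + 1.  This proves "⇐" at once; for "⇒" a Giuga number is squarefree, and
-- a squarefree n divides every number that all its prime factors divide.
module Submission where

open import Defs
open import Data.Nat using (ℕ; _*_; _<_)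
open import Data.Nat.Primality using (Composite)
open import Data.Product using (_×_; ∃-syntax)
open import Function.Bundles using (_⇔_)

open import Data.Nat.Base
open import Data.Nat.Properties
open import Data.Nat.DivMod
open import Data.Nat.Divisibility
open import Data.Nat.Coprimality as Coprime using (Coprime; coprime-divisor)
open import Data.Nat.GCD using (gcd)
open import Data.Nat.Primality
  using (Prime; prime⇒irreducible; prime⇒nonZero; prime⇒nonTrivial; composite⇒nonZero)
open import Data.Nat.Primality.Factorisation
  using (factorise; PrimeFactorisation; module PrimeFactorisation)
open import Data.Nat.ListAction using (sum; product)
open import Data.Nat.ListAction.Properties using (product-↭)
open import Data.Nat.Induction using (<-wellFounded)
open import Data.Nat.Tactic.RingSolver using (solve-∀)
open import Induction.WellFounded using (Acc; acc)
open import Data.List.Base using (List; []; _∷_; map; upTo; applyUpTo; filter; length; _++_)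
open import Data.List.Properties using (map-∘; length-map; length-++-sucʳ)
open import Data.List.Membership.Propositional using (_∈_)
open import Data.List.Membership.Propositional.Properties
  using (∈-filter⁻; ∈-filter⁺; ∈-map⁻; ∈-map⁺; ∈-upTo⁻; ∈-upTo⁺; ∈-∃++; ∈-++⁻; ∈-++⁺ˡ; ∈-++⁺ʳ)
open import Data.List.Relation.Unary.All as All using (All; []; _∷_)
open import Data.List.Relation.Unary.AllPairs using ([]; _∷_)
open import Data.List.Relation.Unary.Any using (here; there)
open import Data.List.Relation.Unary.Unique.Propositional using (Unique)
import Data.List.Relation.Unary.Unique.Propositional.Properties as Unique
open import Data.List.Relation.Binary.Permutation.Propositional
  using (_↭_; ↭-refl; ↭-sym; ↭-trans; ↭-prep)
open import Data.List.Relation.Binary.Permutation.Propositional.Properties using (shift)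
open import Data.Product using (_,_; proj₁; proj₂)
open import Data.Sum using (inj₁; inj₂)
open import Data.Empty using (⊥-elim)
open import Function using (_∘_; id)
open import Function.Bundles using (mk⇔; Equivalence)
open import Relation.Nullary using (¬_; yes; no; contradiction)
open import Relation.Binary.PropositionalEquality

-- Congruence modulo d, expressed through remainders.

module Congruence (d : ℕ) .{{_ : NonZero d}} where

  infix 4 _≈_

  _≈_ : ℕ → ℕ → Set
  x ≈ y = x % d ≡ y % d

  ≈-refl : ∀ {x} → x ≈ x
  ≈-refl = refl

  ≈-sym : ∀ {x y} → x ≈ y → y ≈ x
  ≈-sym = sym

  ≈-trans : ∀ {x y z} → x ≈ y → y ≈ z → x ≈ z
  ≈-trans = trans

  ≡⇒≈ : ∀ {x y} → x ≡ y → x ≈ y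
  ≡⇒≈ = cong (_% d)

  +-cong : ∀ {x x′ y y′} → x ≈ x′ → y ≈ y′ → x + y ≈ x′ + y′
  +-cong {x} {x′} {y} {y′} x≈x′ y≈y′ = begin
    (x + y) % d                 ≡⟨ %-distribˡ-+ x y d ⟩
    (x % d + y % d) % d         ≡⟨ cong₂ (λ a b → (a + b) % d) x≈x′ y≈y′ ⟩
    (x′ % d + y′ % d) % d       ≡⟨ %-distribˡ-+ x′ y′ d ⟨
    (x′ + y′) % d               ∎
    where open ≡-Reasoning

  *-cong : ∀ {x x′ y y′} → x ≈ x′ → y ≈ y′ → x * y ≈ x′ * y′
  *-cong {x} {x′} {y} {y′} x≈x′ y≈y′ = begin
    (x * y) % d                 ≡⟨ %-distribˡ-* x y d ⟩
    (x % d * (y % d)) % d       ≡⟨ cong₂ (λ a b → (a * b) % d) x≈x′ y≈y′ ⟩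
    (x′ % d * (y′ % d)) % d     ≡⟨ %-distribˡ-* x′ y′ d ⟨
    (x′ * y′) % d               ∎
    where open ≡-Reasoning

  ^-cong : ∀ {x y} → x ≈ y → ∀ e → x ^ e ≈ y ^ e
  ^-cong x≈y zero    = ≈-refl
  ^-cong x≈y (suc e) = *-cong x≈y (^-cong x≈y e)

  0%d≡0 : 0 % d ≡ 0
  0%d≡0 = n∣m⇒m%n≡0 0 d (d ∣0)

  ∣⇒≈0 : ∀ {x} → d ∣ x → x ≈ 0
  ∣⇒≈0 {x} d∣x = trans (n∣m⇒m%n≡0 x d d∣x) (sym 0%d≡0)

  ≈0⇒∣ : ∀ {x} → x ≈ 0 → d ∣ x
  ≈0⇒∣ {x} x≈0 = m%n≡0⇒n∣m x d (trans x≈0 0%d≡0)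

  ≈⇒∣∸ : ∀ {x y} → x ≈ y → d ∣ x ∸ y
  ≈⇒∣∸ {x} {y} x≈y = divides (x / d ∸ y / d) (begin
    x ∸ y                                     ≡⟨ cong₂ _∸_ (m≡m%n+[m/n]*n x d) (m≡m%n+[m/n]*n y d) ⟩
    (x % d + x / d * d) ∸ (y % d + y / d * d) ≡⟨ cong (λ r → (x % d + x / d * d) ∸ (r + y / d * d)) x≈y ⟨
    (x % d + x / d * d) ∸ (x % d + y / d * d) ≡⟨ [m+n]∸[m+o]≡n∸o (x % d) (x / d * d) (y / d * d) ⟩
    x / d * d ∸ y / d * d                     ≡⟨ *-distribʳ-∸ d (x / d) (y / d) ⟨
    (x / d ∸ y / d) * d                       ∎)
    where open ≡-Reasoning

  ∣∸⇒≈ : ∀ {x y} → x ≤ y → d ∣ y ∸ x → y ≈ x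
  ∣∸⇒≈ {x} x≤y d∣y∸x = trans (cong (_% d) (sym (m+[n∸m]≡n x≤y))) (%-remove-+ʳ x d∣y∸x)

  ≈⇒≡[mod] : ∀ {x y} → x ≈ y → x ≡ y [mod d ]
  ≈⇒≡[mod] x≈y = ∣m∣n⇒∣m+n (≈⇒∣∸ x≈y) (≈⇒∣∸ (≈-sym x≈y))

  ≡[mod]⇒≈ : ∀ {x y} → x ≡ y [mod d ] → x ≈ y
  ≡[mod]⇒≈ {x} {y} d∣diff with ≤-total x y
  ... | inj₁ x≤y = ≈-sym (∣∸⇒≈ x≤y (subst (d ∣_) (cong (_+ (y ∸ x)) (m≤n⇒m∸n≡0 x≤y)) d∣diff))
  ... | inj₂ y≤x = ∣∸⇒≈ y≤x
    (subst (d ∣_) (trans (cong ((x ∸ y) +_) (m≤n⇒m∸n≡0 y≤x)) (+-identityʳ (x ∸ y))) d∣diff)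

  ≈1⇒coprime : ∀ {x} → x ≈ 1 → Coprime x d
  ≈1⇒coprime x≈1 (c∣x , c∣d) =
    ∣1⇒≡1 (∣n∣m%n⇒∣m c∣d (subst (_ ∣_) x≈1 (%-presˡ-∣ c∣x c∣d)))

  *-cancelʳ-≈ : ∀ {c x y} → Coprime c d → x * c ≈ y * c → x ≈ y
  *-cancelʳ-≈ {c} {x} {y} c⊥d xc≈yc =
    ≡[mod]⇒≈ (∣m∣n⇒∣m+n (cancel {x} {y} xc≈yc) (cancel {y} {x} (≈-sym {x * c} xc≈yc)))
    where
      cancel : ∀ {x y} → x * c ≈ y * c → d ∣ x ∸ y
      cancel {x} {y} h =
        coprime-divisor (Coprime.sym c⊥d)
          (subst (d ∣_) (trans (sym (*-distribʳ-∸ c x y)) (*-comm (x ∸ y) c)) (≈⇒∣∸ h))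

∣-^ : ∀ x {k} → 0 < k → x ∣ x ^ k
∣-^ x {suc k} _ = m∣m*n (x ^ k)

cofactor>0 : ∀ {n q p} .{{_ : NonZero n}} → n ≡ q * p → 0 < q
cofactor>0 {n} {zero} n≡0 = contradiction n≡0 (≢-nonZero⁻¹ n)
cofactor>0 {q = suc _} _  = z<s

prime>1 : ∀ {p} → Prime p → 1 < p
prime>1 {p} p-prime = nonTrivial⇒n>1 p {{prime⇒nonTrivial p-prime}}

¬∣⇒coprime : ∀ {p a} → Prime p → ¬ p ∣ a → Coprime p a
¬∣⇒coprime p-prime p∤a (c∣p , c∣a) with prime⇒irreducible p-prime c∣p
... | inj₁ c≡1 = c≡1
... | inj₂ refl = contradiction c∣a p∤a

coprime-* : ∀ {a m k} → Coprime a m → Coprime a k → Coprime a (m * k)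
coprime-* {a} {m} a⊥m a⊥k {c} (c∣a , c∣mk) = a⊥k (c∣a , coprime-divisor c⊥m c∣mk)
  where
    c⊥m : Coprime c m
    c⊥m (e∣c , e∣m) = a⊥m (∣-trans e∣c c∣a , e∣m)

coprime-product : ∀ {n} xs → All (λ x → Coprime x n) xs → Coprime (product xs) n
coprime-product []       []            = Coprime.1-coprimeTo _
coprime-product (x ∷ xs) (x⊥n ∷ xs⊥n) =
  Coprime.sym (coprime-* (Coprime.sym x⊥n) (Coprime.sym (coprime-product xs xs⊥n)))

coprime-∣-* : ∀ {m d X} → Coprime m d → m ∣ X → d ∣ X → m * d ∣ X
coprime-∣-* {m} {d} m⊥d m∣X (divides t refl) =
  *-monoˡ-∣ d (coprime-divisor m⊥d (subst (m ∣_) (*-comm t d) m∣X))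

Σ< : (ℕ → ℕ) → ℕ → ℕ
Σ< f zero    = 0
Σ< f (suc k) = f 0 + Σ< (f ∘ suc) k

Σ<-+ : ∀ f a b → Σ< f (a + b) ≡ Σ< f a + Σ< (λ i → f (a + i)) b
Σ<-+ f zero    b = refl
Σ<-+ f (suc a) b = trans (cong (f 0 +_) (Σ<-+ (f ∘ suc) a b)) (sym (+-assoc (f 0) _ _))

sum-map-applyUpTo : ∀ (f h : ℕ → ℕ) k → sum (map f (applyUpTo h k)) ≡ Σ< (f ∘ h) k
sum-map-applyUpTo f h zero    = refl
sum-map-applyUpTo f h (suc k) = cong (f (h 0) +_) (sum-map-applyUpTo f (h ∘ suc) k)

-- For a positive exponent the missing term 0^e is 0, so powSum n e = Σ_{i<n} i^e.
powSum≡Σ< : ∀ n′ e′ → powSum (suc n′) (suc e′) ≡ Σ< (λ i → i ^ suc e′) (suc n′)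
powSum≡Σ< n′ e′ =
  trans (cong sum (sym (map-∘ (upTo n′)))) (sum-map-applyUpTo (λ i → suc i ^ suc e′) id n′)

-- Sums over full periods modulo d.

module PeriodicSums (d : ℕ) .{{_ : NonZero d}} where
  open Congruence d

  -- f is ≡ 0 (mod d) on multiples of d and ≡ 1 (mod d) elsewhere;
  -- j ↦ j^e is such a function when e is admissible for a prime d.
  UnitIndicator : (ℕ → ℕ) → Set
  UnitIndicator f = ∀ j → (d ∣ j → f j ≈ 0) × (¬ d ∣ j → f j ≈ 1)

  Σ<-ones : ∀ k g → (∀ i → i < k → g i ≈ 1) → Σ< g k ≈ k
  Σ<-ones zero    g _    = ≈-refl
  Σ<-ones (suc k) g g≈1 =
    +-cong (g≈1 0 z<s) (Σ<-ones k (g ∘ suc) (λ i i<k → g≈1 (suc i) (s<s i<k)))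

  -- One period contributes 0 + (d − 1)·1 ≡ −1.
  period : ∀ f → UnitIndicator f → Σ< f d + 1 ≈ 0
  period f ind = subst (λ k → Σ< f k + 1 ≈ 0) (suc-pred d) one-period
    where
      m : ℕ
      m = pred d
      tail≈m : Σ< (f ∘ suc) m ≈ m
      tail≈m = Σ<-ones m (f ∘ suc) λ i i<m →
        proj₂ (ind (suc i)) λ d∣ → <⇒≱ (subst (suc i <_) (suc-pred d) (s<s i<m)) (∣⇒≤ d∣)
      one-period : Σ< f (suc m) + 1 ≈ 0
      one-period = ≈-trans (+-cong (+-cong (proj₁ (ind 0) (d ∣0)) tail≈m) ≈-refl)
                           (≈-trans (≡⇒≈ (trans (+-comm m 1) (suc-pred d))) (∣⇒≈0 ∣-refl))

  shift-period : ∀ f → UnitIndicator f → UnitIndicator (λ i → f (d + i))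
  shift-period f ind i =
    (λ d∣i → proj₁ (ind (d + i)) (∣m∣n⇒∣m+n ∣-refl d∣i)) ,
    (λ d∤i → proj₂ (ind (d + i)) (λ d∣d+i → d∤i (∣m+n∣m⇒∣n d∣d+i ∣-refl)))

  periods : ∀ q f → UnitIndicator f → Σ< f (q * d) + q ≈ 0
  periods zero    f ind = ≈-refl
  periods (suc q) f ind =
    ≈-trans (≡⇒≈ regroup) (+-cong (period f ind) (periods q _ (shift-period f ind)))
    where
      rearrange : ∀ a b q → a + b + suc q ≡ (a + 1) + (b + q)
      rearrange = solve-∀
      regroup : Σ< f (d + q * d) + suc q ≡ (Σ< f d + 1) + (Σ< (λ i → f (d + i)) (q * d) + q)
      regroup = trans (cong (_+ suc q) (Σ<-+ f d (q * d)))
                      (rearrange (Σ< f d) (Σ< (λ i → f (d + i)) (q * d)) q)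

map-unique : ∀ {A B : Set} (f : A → B) xs → Unique xs →
             (∀ {x y} → x ∈ xs → y ∈ xs → f x ≡ f y → x ≡ y) → Unique (map f xs)
map-unique f []       []           _   = []
map-unique f (x ∷ xs) (x∉xs ∷ xs!) inj =
  All.tabulate fx∉ ∷ map-unique f xs xs! (λ x∈ y∈ → inj (there x∈) (there y∈))
  where
    fx∉ : ∀ {z} → z ∈ map f xs → ¬ f x ≡ z
    fx∉ z∈ with ∈-map⁻ f z∈
    ... | y , y∈ , refl = λ fx≡fy → All.lookup x∉xs y∈ (inj (here refl) (there y∈) fx≡fy)

unique-⊆⇒↭ : ∀ {A : Set} (xs ys : List A) → Unique xs → (∀ {x} → x ∈ xs → x ∈ ys) →
             length ys ≤ length xs → xs ↭ ys
unique-⊆⇒↭ []       []      _            _    _  = ↭-refl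
unique-⊆⇒↭ (x ∷ xs) ys      (x∉xs ∷ xs!) xs⊆ys len with ∈-∃++ (xs⊆ys (here refl))
... | as , bs , refl =
  ↭-trans (↭-prep x (unique-⊆⇒↭ xs (as ++ bs) xs! xs⊆as++bs len′)) (↭-sym (shift x as bs))
  where
    xs⊆as++bs : ∀ {y} → y ∈ xs → y ∈ as ++ bs
    xs⊆as++bs {y} y∈ with ∈-++⁻ as (xs⊆ys (there y∈))
    ... | inj₁ y∈as         = ∈-++⁺ˡ y∈as
    ... | inj₂ (here refl)  = ⊥-elim (All.lookup x∉xs y∈ refl)
    ... | inj₂ (there y∈bs) = ∈-++⁺ʳ as y∈bs
    len′ : length (as ++ bs) ≤ length xs
    len′ = ≤-pred (subst (_≤ suc (length xs)) (length-++-sucʳ as x bs) len)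

-- Euler's theorem.

units : ℕ → List ℕ
units n = filter (λ k → gcd k n ≟ 1) (range1 n)

∈units⁻ : ∀ {n u} → u ∈ units n → 0 < u × u ≤ n × Coprime u n
∈units⁻ {n} u∈ with ∈-filter⁻ (λ k → gcd k n ≟ 1) {xs = range1 n} u∈
... | u∈range , gcd≡1 with ∈-map⁻ suc {xs = upTo n} u∈range
... | i , i∈ , refl = z<s , ∈-upTo⁻ i∈ , Coprime.gcd≡1⇒coprime gcd≡1

∈units⁺ : ∀ {n u} → 0 < u → u ≤ n → Coprime u n → u ∈ units n
∈units⁺ {n} {suc i} _ u≤n u⊥n =
  ∈-filter⁺ (λ k → gcd k n ≟ 1) (∈-map⁺ suc (∈-upTo⁺ u≤n)) (Coprime.coprime⇒gcd≡1 u⊥n)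

units-unique : ∀ n → Unique (units n)
units-unique n = Unique.filter⁺ (λ k → gcd k n ≟ 1) (Unique.map⁺ suc-injective (Unique.upTo⁺ n))

-- 1 is a reduced residue, so φ n > 0.
φ>0 : ∀ n .{{_ : NonZero n}} → 0 < φ n
φ>0 n = nonempty (∈units⁺ z<s (>-nonZero⁻¹ n) (Coprime.1-coprimeTo n))
  where
    nonempty : ∀ {xs : List ℕ} → 1 ∈ xs → 0 < length xs
    nonempty {_ ∷ _} _ = z<s

-- For a coprime to n > 1, u ↦ a u mod n permutes the reduced residues; comparing
-- products gives a^φ(n) P ≡ P with P coprime to n.
module Euler (n : ℕ) .{{_ : NonZero n}} (1<n : 1 < n) (a : ℕ) (a⊥n : Coprime a n) where
  open Congruence n

  mul : ℕ → ℕ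
  mul u = (a * u) % n

  mul-units : ∀ {u} → u ∈ units n → mul u ∈ units n
  mul-units {u} u∈ = ∈units⁺ (n≢0⇒n>0 mul≢0) (<⇒≤ (m%n<n (a * u) n)) mul⊥n
    where
      mul⊥n : Coprime (mul u) n
      mul⊥n (c∣mul , c∣n) =
        Coprime.sym (coprime-* (Coprime.sym a⊥n) (Coprime.sym (proj₂ (proj₂ (∈units⁻ {n} u∈)))))
          (∣n∣m%n⇒∣m c∣n c∣mul , c∣n)
      mul≢0 : ¬ mul u ≡ 0
      mul≢0 eq =
        <⇒≢ 1<n (sym (Coprime.0-coprimeTo-m⇒m≡1 (subst (λ x → Coprime x n) eq mul⊥n)))

  -- a u ≡ a v forces n ∣ u − v, and 0 ≤ u − v < n as 1 ≤ u, v ≤ n.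
  mul-injective : ∀ {u v} → u ∈ units n → v ∈ units n → mul u ≡ mul v → u ≡ v
  mul-injective u∈ v∈ eq = ≤-antisym (below u∈ v∈ eq) (below v∈ u∈ (sym eq))
    where
      below : ∀ {u v} → u ∈ units n → v ∈ units n → mul u ≡ mul v → u ≤ v
      below {u} {v} u∈ v∈ eq with ∈units⁻ {n} u∈ | ∈units⁻ {n} v∈
      ... | 0<u , u≤n , _ | 0<v , _ , _ =
        m∸n≡0⇒m≤n (small-multiple n∣u∸v (<-≤-trans (∸< 0<u 0<v) u≤n))
        where
          ∸< : ∀ {u v} → 0 < u → 0 < v → u ∸ v < u
          ∸< {suc u} {suc v} _ _ = s≤s (m∸n≤m u v)
          n∣u∸v : n ∣ u ∸ v
          n∣u∸v = coprime-divisor (Coprime.sym a⊥n)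
                    (subst (n ∣_) (sym (*-distribˡ-∸ a u v)) (≈⇒∣∸ {a * u} {a * v} eq))
          small-multiple : ∀ {x} → n ∣ x → x < n → x ≡ 0
          small-multiple {zero}  _   _   = refl
          small-multiple {suc x} n∣x x<n = contradiction (∣⇒≤ n∣x) (<⇒≱ x<n)

  mul-permutes : map mul (units n) ↭ units n
  mul-permutes =
    unique-⊆⇒↭ (map mul (units n)) (units n)
      (map-unique mul (units n) (units-unique n) mul-injective)
      mul-∈ (≤-reflexive (sym (length-map mul (units n))))
    where
      mul-∈ : ∀ {y} → y ∈ map mul (units n) → y ∈ units n
      mul-∈ y∈ with ∈-map⁻ mul y∈
      ... | u , u∈ , refl = mul-units u∈

  product-mul : ∀ xs → product (map mul xs) ≈ a ^ length xs * product xs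
  product-mul []       = ≈-refl
  product-mul (x ∷ xs) =
    ≈-trans (*-cong (m%n%n≡m%n (a * x) n) (product-mul xs)) (≡⇒≈ (interchange a x _ _))
    where
      interchange : ∀ a x b c → (a * x) * (b * c) ≡ (a * b) * (x * c)
      interchange = solve-∀

  a^φ≈1 : a ^ φ n ≈ 1
  a^φ≈1 = *-cancelʳ-≈ P⊥n
    (≈-trans (≈-sym (product-mul (units n)))
             (≡⇒≈ (trans (product-↭ mul-permutes) (sym (*-identityˡ P)))))
    where
      P : ℕ
      P = product (units n)
      P⊥n : Coprime P n
      P⊥n = coprime-product (units n) (All.tabulate λ u∈ → proj₂ (proj₂ (∈units⁻ {n} u∈)))

euler : ∀ n .{{_ : NonZero n}} → ExponentKills n (φ n)
euler (suc zero)      _ _   = 1∣ _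
euler n@(suc (suc _)) a a⊥n =
  Congruence.≈⇒≡[mod] n {a ^ φ n} (Euler.a^φ≈1 n (s<s z<s) a a⊥n)

-- Positive multiples of an admissible exponent are admissible: (a^e)^K ≡ 1^K.
exponent-multiple : ∀ {n e} .{{_ : NonZero n}} K → ExponentKills n e → ExponentKills n (K * e)
exponent-multiple {n} {e} K kills a a⊥n =
  ≈⇒≡[mod] {a ^ (K * e)} (subst (_≈ 1) a^eK≡a^Ke (≈-trans a^eK≈1^K (≡⇒≈ (^-zeroˡ K))))
  where
    open Congruence n
    a^eK≡a^Ke : (a ^ e) ^ K ≡ a ^ (K * e)
    a^eK≡a^Ke = trans (^-*-assoc a e K) (cong (a ^_) (*-comm e K))
    a^eK≈1^K : (a ^ e) ^ K ≈ 1 ^ K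
    a^eK≈1^K = ^-cong (≡[mod]⇒≈ {a ^ e} (kills a a⊥n)) K

-- Working modulo a prime factor p.

module PrimeModulus {p : ℕ} (p-prime : Prime p) where
  instance
    p≢0 : NonZero p
    p≢0 = prime⇒nonZero p-prime

  open Congruence p
  open PeriodicSums p

  -- Chinese remainder step, from Euler's theorem: for p ∤ m the number
  -- a = j·m^φ(p) + p^φ(m) satisfies a ≡ j (mod p) and a ≡ 1 (mod m).
  crt : ∀ {m} .{{_ : NonZero m}} j → Coprime p m → ∃[ a ] (a ≈ j × Coprime a m)
  crt {m} j p⊥m = j * m ^ φ p + p ^ φ m , a≈j , Mod-m.≈1⇒coprime a≈1
    where
      module Mod-m = Congruence m
      a≈j : j * m ^ φ p + p ^ φ m ≈ j
      a≈j = ≈-trans (+-cong (*-cong (≈-refl {j}) (≡[mod]⇒≈ (euler p m (Coprime.sym p⊥m))))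
                            (∣⇒≈0 (∣-^ p (φ>0 m))))
                    (≡⇒≈ (trans (+-identityʳ (j * 1)) (*-identityʳ j)))
      a≈1 : j * m ^ φ p + p ^ φ m Mod-m.≈ 1
      a≈1 = Mod-m.+-cong (Mod-m.∣⇒≈0 (∣n⇒∣m*n j (∣-^ m (φ>0 p))))
                         (Mod-m.≡[mod]⇒≈ (euler m p p⊥m))

  -- Every class j with p ∤ j contains a number coprime to m ≥ 1: strip the factors p
  -- from m and apply crt to what remains.
  coprime-representative : ∀ m .{{_ : NonZero m}} j → ¬ p ∣ j → ∃[ a ] (a ≈ j × Coprime a m)
  coprime-representative m j p∤j = go m (<-wellFounded m)
    where
      go : ∀ m → Acc _<_ m → .{{_ : NonZero m}} → ∃[ a ] (a ≈ j × Coprime a m)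
      go m (acc smaller) with p ∣? m
      ... | no p∤m = crt j (¬∣⇒coprime p-prime p∤m)
      ... | yes (divides q refl) =
        extend (go q (smaller (m<m*n q p {{q≢0}} (prime>1 p-prime))) {{q≢0}})
        where
          q≢0 : NonZero q
          q≢0 = m*n≢0⇒m≢0 q
          -- a ≡ j (mod p) is prime to p, so coprimality to q extends to q p
          extend : ∃[ a ] (a ≈ j × Coprime a q) → ∃[ a ] (a ≈ j × Coprime a (q * p))
          extend (a , a≈j , a⊥q) =
            a , a≈j , coprime-* a⊥q (Coprime.sym (¬∣⇒coprime p-prime p∤a))
            where
              p∤a : ¬ p ∣ a
              p∤a p∣a = p∤j (≈0⇒∣ (≈-trans (≈-sym a≈j) (∣⇒≈0 p∣a)))

  unit-power : ∀ {n e} .{{_ : NonZero n}} → ExponentKills n e → p ∣ n →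
               ∀ j → ¬ p ∣ j → j ^ e ≈ 1
  unit-power {n} {e} kills p∣n j p∤j with coprime-representative n j p∤j
  ... | a , a≈j , a⊥n =
    ≈-trans (^-cong (≈-sym a≈j) e) (≡[mod]⇒≈ {a ^ e} (∣-trans p∣n (kills a a⊥n)))

  powSum-mod-prime : ∀ {n′ e′ q} → ExponentKills (suc n′) (suc e′) → suc n′ ≡ q * p →
                     p ∣ powSum (suc n′) (suc e′) + q
  powSum-mod-prime {n′} {e′} {q} kills n≡qp =
    ≈0⇒∣ (subst (λ s → s + q ≈ 0) (sym powSum≡Σ) (periods q f indicator))
    where
      f : ℕ → ℕ
      f j = j ^ suc e′
      indicator : UnitIndicator f
      indicator j = (λ p∣j → ∣⇒≈0 (∣m⇒∣m*n (j ^ e′) p∣j)) ,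
                    unit-power {suc n′} {suc e′} kills (divides q n≡qp) j
      powSum≡Σ : powSum (suc n′) (suc e′) ≡ Σ< f (q * p)
      powSum≡Σ = trans (powSum≡Σ< n′ e′) (cong (Σ< f) n≡qp)

SquareFree : ℕ → Set
SquareFree n = ∀ {p} → Prime p → ¬ (p * p ∣ n)

GiugaCondition : ℕ → Set
GiugaCondition n = ∀ p q → Prime p → n ≡ q * p → p ∣ q ∸ 1

-- If p² ∣ n = q p then p ∣ q; together with p ∣ q − 1 this gives p ∣ 1.
giuga⇒squarefree : ∀ {n} .{{_ : NonZero n}} → GiugaCondition n → SquareFree n
giuga⇒squarefree {n} giuga {p} p-prime pp∣n with ∣-trans (n∣m*n p) pp∣n
... | divides q n≡qp = <⇒≢ (prime>1 p-prime) (sym (∣1⇒≡1 p∣1))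
  where
    instance
      p≢0 : NonZero p
      p≢0 = prime⇒nonZero p-prime
    p∣q : p ∣ q
    p∣q = *-cancelʳ-∣ p (subst (p * p ∣_) n≡qp pp∣n)
    p∣1 : p ∣ 1
    p∣1 = ∣m+n∣m⇒∣n (subst (p ∣_) (sym (m∸n+n≡m (cofactor>0 n≡qp))) p∣q)
                    (giuga p q p-prime n≡qp)

-- A squarefree n divides every X that all prime factors of n divide: run through the
-- prime factorisation of n, whose primes are distinct.
squarefree-∣ : ∀ {n X} .{{_ : NonZero n}} → SquareFree n →
               (∀ {p} → Prime p → p ∣ n → p ∣ X) → n ∣ X
squarefree-∣ {n} {X} squarefree primes∣X =
  subst (_∣ X) (sym n≡∏) (go (factors fact) (factorsPrime fact) (∣-reflexive (sym n≡∏)))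
  where
    open PrimeFactorisation
    fact : PrimeFactorisation n
    fact = factorise n
    n≡∏ : n ≡ product (factors fact)
    n≡∏ = isFactorisation fact
    go : ∀ ps → All Prime ps → product ps ∣ n → product ps ∣ X
    go []       []                   _ = 1∣ X
    go (p ∷ ps) (p-prime ∷ ps-prime) h =
      coprime-∣-* (¬∣⇒coprime p-prime p∤rest) (primes∣X p-prime (∣-trans (m∣m*n _) h))
                  (go ps ps-prime (∣-trans (n∣m*n p) h))
      where
        p∤rest : ¬ p ∣ product ps
        p∤rest p∣rest = squarefree p-prime (∣-trans (*-monoʳ-∣ p p∣rest) h)

giuga⇔powSum : ∀ n → Composite n → ∀ e → 0 < e → ExponentKills n e →
               Giuga n ⇔ powSum n e ≡-1[mod n ]
giuga⇔powSum zero       c _        _ _     = contradiction refl (≢-nonZero⁻¹ 0 {{composite⇒nonZero c}})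
giuga⇔powSum n@(suc n′) c (suc e′) _ kills = mk⇔ to from
  where
    P : ℕ
    P = powSum n (suc e′)
    at-prime : ∀ {p q} → Prime p → n ≡ q * p → p ∣ (P + 1) + (q ∸ 1)
    at-prime {p} {q} p-prime n≡qp =
      subst (p ∣_) regroup (PrimeModulus.powSum-mod-prime p-prime {n′} {e′} {q} kills n≡qp)
      where
        regroup : P + q ≡ (P + 1) + (q ∸ 1)
        regroup = trans (cong (P +_) (sym (m+[n∸m]≡n (cofactor>0 n≡qp))))
                        (sym (+-assoc P 1 (q ∸ 1)))
    from : n ∣ P + 1 → Giuga n
    from n∣P+1 = c , λ p q p-prime n≡qp →
      ∣m+n∣m⇒∣n (at-prime {p} {q} p-prime n≡qp) (∣-trans (divides q n≡qp) n∣P+1)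
    to : Giuga n → n ∣ P + 1
    to (_ , giuga) = squarefree-∣ (giuga⇒squarefree giuga) λ { {p} p-prime (divides q n≡qp) →
      ∣m+n∣m⇒∣n (subst (p ∣_) (+-comm (P + 1) (q ∸ 1)) (at-prime {p} {q} p-prime n≡qp))
                (giuga p q p-prime n≡qp) }

giuga⇔multiples : ∀ n → Composite n → ∀ e → 0 < e → ExponentKills n e →
  (Giuga n ⇔ (∃[ K ] (0 < K × powSum n (K * e) ≡-1[mod n ]))) ×
  (Giuga n ⇔ (∀ K → 0 < K → powSum n (K * e) ≡-1[mod n ]))
giuga⇔multiples n c e@(suc _) _ kills =
  mk⇔ (λ g → 1 , z<s , to (criterion 1 z<s) g) (λ (K , K>0 , h) → from (criterion K K>0) h) ,
  mk⇔ (λ g K K>0 → to (criterion K K>0) g) (λ h → from (criterion 1 z<s) (h 1 z<s))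
  where
    open Equivalence
    criterion : ∀ K → 0 < K → Giuga n ⇔ powSum n (K * e) ≡-1[mod n ]
    criterion K@(suc _) _ =
      giuga⇔powSum n c (K * e) z<s (exponent-multiple {n} {e} {{composite⇒nonZero c}} K kills)

-- The six conditions (i)–(vi): apply the criterion to e = λ(n) (only its admissibility
-- is needed, not its minimality) and, via Euler's theorem, to e = φ(n).
corollary1 : (n : ℕ) → Composite n → (lam : ℕ) → IsCarmichaelλ n lam →
    ((Giuga n ⇔ powSum n lam ≡-1[mod n ])
    × (Giuga n ⇔ (∀ K → 0 < K → powSum n (K * lam) ≡-1[mod n ]))
    × (Giuga n ⇔ (∃[ K ] (0 < K × powSum n (K * lam) ≡-1[mod n ])))
    × (Giuga n ⇔ (∃[ K ] (0 < K × powSum n (K * φ n) ≡-1[mod n ])))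
    × (Giuga n ⇔ (∀ K → 0 < K → powSum n (K * φ n) ≡-1[mod n ])))
corollary1 n c lam (lam>0 , lam-kills , _)
  with giuga⇔multiples n c lam lam>0 lam-kills
     | giuga⇔multiples n c (φ n) (φ>0 n {{n≢0}}) (euler n {{n≢0}})
  where
    n≢0 : NonZero n
    n≢0 = composite⇒nonZero c
... | via-λ-some , via-λ-all | via-φ =
  giuga⇔powSum n c lam lam>0 lam-kills , via-λ-all , via-λ-some , via-φ
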